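{- For every $n\ge1$, \[\sum_{k,\ell,d\ge0}\binom{n-1-d}{\ell}\binom{n-1-k}{d}\binom{n-1-\ell}{k}=\tfrac12F_{3n},\] where $F_m$ is the Fibonacci number with $F_0=0$, $F_1=1$, $F_m=F_{m-1}+F_{m-2}$.
   Context: Binomial coefficients $\binom{a}{b}$ with $a<b$ (including negative $a$ arising here) are taken to be $0$, so the sum is finite. -}

module Defs where

open import Data.Nat using (ℕ; zero; suc; _+_; _∸_; _≤ᵇ_)
open import Data.Nat.Combinatorics using (_C_)
open import Data.Integer using (ℤ; +_; -[1+_])
open import Data.Bool using (if_then_else_)

fib : ℕ → ℕ
fib zero = 0
fib (suc zero) = 1
fib (suc (suc m)) = fib (suc m) + fib m

-- Binomial coefficient with integer top argument: (a choose b), zero when a < 0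
-- (consistent with the convention that (a choose b) = 0 when a < b, b ≥ 0).
binomℤ : ℤ → ℕ → ℕ
binomℤ (+ a) b = a C b
binomℤ -[1+ _ ] b = 0

sub1 : ℕ → ℕ → ℤ
sub1 n x = (+ n) Data.Integer.- (+ 1) Data.Integer.- (+ x)

sumBelow : ℕ → (ℕ → ℕ) → ℕ
sumBelow zero f = 0
sumBelow (suc N) f = sumBelow N f + f N

term : ℕ → ℕ → ℕ → ℕ → ℕ
term n k ℓ d = binomℤ (sub1 n d) ℓ Data.Nat.* binomℤ (sub1 n k) d Data.Nat.* binomℤ (sub1 n ℓ) k

-- The full sum over k, ℓ, d ≥ 0.  Every term with k ≥ n, ℓ ≥ n or d ≥ n vanishes
-- (e.g. k ≥ n gives C(n-1-ℓ, k) = 0 since n-1-ℓ < k), so summing over k, ℓ, d < n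
-- is the full (finite) sum.
tripleSum : ℕ → ℕ
tripleSum n = sumBelow n λ k → sumBelow n λ ℓ → sumBelow n λ d → term n k ℓ d

{-# OPTIONS --safe #-}
module Submission where

-- Let Ψ_M f = (1 + x)^M f(1/(1 + x)) for polynomials f of degree ≤ M, so that
-- [x^d] Ψ_M f = Σ_k C(M - k, d) f_k. Since (a + b/(1 + x))(1 + x) = (a + b) + a x,
-- Ψ_{j+i} sends (a + b x)^j (c + e x)^i to ((a + b) + a x)^j ((c + e) + c x)^i.
-- With m = n - 1, the sum over ℓ is [x^k] Ψ_m((1 + x)^(m-d)) = [x^k] (2 + x)^(m-d) (1 + x)^d,
-- and the sum over k is then [x^d] Ψ_m of that, namely [x^d] (3 + 2x)^(m-d) (2 + x)^d.
-- Multiplying out (2 + x)(3 + 2x), the coefficients h(i, j) = [x^i] (3 + 2x)^j (2 + x)^i satisfy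
-- h(i+1, j+1) = h(i, j+1) + 3 h(i+1, j) + h(i, j), so their antidiagonal sums D_m satisfy
-- D_(m+2) = 4 D_(m+1) + D_m, as F_(3m+3) does; and 2 D_0 = F_3, 2 D_1 = F_6.

open import Defs
open import Data.Nat using (ℕ; zero; suc; _+_; _*_; _∸_; _≤_; _<_; s≤s)
open import Data.Nat.Properties
open import Data.Nat.Combinatorics using (_C_; nCk+nC[k+1]≡[n+1]C[k+1])
open import Data.Nat.Tactic.RingSolver using (solve-∀)
import Data.Integer.Properties as ℤ
open import Algebra.Properties.CommutativeSemigroup +-commutativeSemigroup using (interchange)
open import Function using (_∘_)
open import Relation.Binary.PropositionalEquality
  using (_≡_; _≗_; refl; sym; trans; cong; cong₂; module ≡-Reasoning)
open ≡-Reasoning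

sumBelow-cong : ∀ N {f g : ℕ → ℕ} → (∀ i → i < N → f i ≡ g i) →
                sumBelow N f ≡ sumBelow N g
sumBelow-cong zero    f≡g = refl
sumBelow-cong (suc N) f≡g =
  cong₂ _+_ (sumBelow-cong N (λ i i<N → f≡g i (m<n⇒m<1+n i<N))) (f≡g N (n<1+n N))

sumBelow-suc : ∀ N (f : ℕ → ℕ) → sumBelow (suc N) f ≡ f 0 + sumBelow N (f ∘ suc)
sumBelow-suc zero    f = sym (+-identityʳ (f 0))
sumBelow-suc (suc N) f = trans (cong (_+ f (suc N)) (sumBelow-suc N f)) (+-assoc (f 0) _ _)

sumBelow-distrib-+ : ∀ N (f g : ℕ → ℕ) →
                     sumBelow N (λ i → f i + g i) ≡ sumBelow N f + sumBelow N g
sumBelow-distrib-+ zero    f g = refl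
sumBelow-distrib-+ (suc N) f g =
  trans (cong (_+ (f N + g N)) (sumBelow-distrib-+ N f g))
        (interchange (sumBelow N f) (sumBelow N g) (f N) (g N))

*-distribˡ-sumBelow : ∀ c N (f : ℕ → ℕ) → c * sumBelow N f ≡ sumBelow N (λ i → c * f i)
*-distribˡ-sumBelow c zero    f = *-zeroʳ c
*-distribˡ-sumBelow c (suc N) f =
  trans (*-distribˡ-+ c (sumBelow N f) (f N)) (cong (_+ c * f N) (*-distribˡ-sumBelow c N f))

sumBelow-zero : ∀ N → sumBelow N (λ _ → 0) ≡ 0
sumBelow-zero zero    = refl
sumBelow-zero (suc N) = cong (_+ 0) (sumBelow-zero N)

sumBelow-comm : ∀ N M (f : ℕ → ℕ → ℕ) →
                sumBelow N (λ i → sumBelow M (f i)) ≡ sumBelow M (λ j → sumBelow N (λ i → f i j))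
sumBelow-comm zero    M f = sym (sumBelow-zero M)
sumBelow-comm (suc N) M f =
  trans (cong (_+ sumBelow M (f N)) (sumBelow-comm N M f)) (sym (sumBelow-distrib-+ M _ (f N)))

[1+n]C[1+k]≡nC[1+k]+nCk : ∀ n k → suc n C suc k ≡ n C suc k + n C k
[1+n]C[1+k]≡nC[1+k]+nCk n k = trans (sym (nCk+nC[k+1]≡[n+1]C[k+1] n k)) (+-comm (n C k) _)

-- Polynomials as coefficient sequences: mulLinear a b f is (a + b x) f
-- and powLinear a b j f is (a + b x)^j f.
Poly : Set
Poly = ℕ → ℕ

one : Poly
one zero    = 1
one (suc _) = 0

mulLinear : ℕ → ℕ → Poly → Poly
mulLinear a b f zero    = a * f zero
mulLinear a b f (suc k) = a * f (suc k) + b * f k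

powLinear : ℕ → ℕ → ℕ → Poly → Poly
powLinear a b zero    f = f
powLinear a b (suc j) f = mulLinear a b (powLinear a b j f)

mulLinear-cong : ∀ a b {f g} → f ≗ g → mulLinear a b f ≗ mulLinear a b g
mulLinear-cong a b f≗g zero    = cong (a *_) (f≗g zero)
mulLinear-cong a b f≗g (suc k) = cong₂ (λ x y → a * x + b * y) (f≗g (suc k)) (f≗g k)

powLinear-cong : ∀ a b j {f g} → f ≗ g → powLinear a b j f ≗ powLinear a b j g
powLinear-cong a b zero    f≗g = f≗g
powLinear-cong a b (suc j) f≗g = mulLinear-cong a b (powLinear-cong a b j f≗g)

mulLinear-comm : ∀ a b c e f → mulLinear a b (mulLinear c e f) ≗ mulLinear c e (mulLinear a b f)
mulLinear-comm a b c e f zero          = constant a c (f 0)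
  where
  constant : ∀ a c x → a * (c * x) ≡ c * (a * x)
  constant = solve-∀
mulLinear-comm a b c e f (suc zero)    = linear a b c e (f 1) (f 0)
  where
  linear : ∀ a b c e x y → a * (c * x + e * y) + b * (c * y) ≡ c * (a * x + b * y) + e * (a * y)
  linear = solve-∀
mulLinear-comm a b c e f (suc (suc k)) = generic a b c e (f (2 + k)) (f (1 + k)) (f k)
  where
  generic : ∀ a b c e x y z → a * (c * x + e * y) + b * (c * y + e * z)
                             ≡ c * (a * x + b * y) + e * (a * y + b * z)
  generic = solve-∀

powLinear-mulLinear-comm : ∀ a b c e j f →
                           powLinear a b j (mulLinear c e f) ≗ mulLinear c e (powLinear a b j f)
powLinear-mulLinear-comm a b c e zero    f k = refl
powLinear-mulLinear-comm a b c e (suc j) f k =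
  trans (mulLinear-cong a b (powLinear-mulLinear-comm a b c e j f) k) (mulLinear-comm a b c e _ k)

mulLinear-1-1 : ∀ f k → mulLinear 1 1 f (suc k) ≡ f (suc k) + f k
mulLinear-1-1 f k = cong₂ _+_ (*-identityˡ (f (suc k))) (*-identityˡ (f k))

mulLinear-1-0 : ∀ f → mulLinear 1 0 f ≗ f
mulLinear-1-0 f zero    = *-identityˡ (f zero)
mulLinear-1-0 f (suc k) = trans (+-identityʳ (1 * f (suc k))) (*-identityˡ (f (suc k)))

powLinear-1-0 : ∀ i f → powLinear 1 0 i f ≗ f
powLinear-1-0 zero    f k = refl
powLinear-1-0 (suc i) f k = trans (mulLinear-1-0 _ k) (powLinear-1-0 i f k)

powLinear-1-1-one : ∀ j → powLinear 1 1 j one ≗ j C_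
powLinear-1-1-one zero    zero    = refl
powLinear-1-1-one zero    (suc k) = refl
powLinear-1-1-one (suc j) zero    = trans (*-identityˡ _) (powLinear-1-1-one j zero)
powLinear-1-1-one (suc j) (suc k) = begin
  mulLinear 1 1 (powLinear 1 1 j one) (suc k)
    ≡⟨ mulLinear-1-1 (powLinear 1 1 j one) k ⟩
  powLinear 1 1 j one (suc k) + powLinear 1 1 j one k
    ≡⟨ cong₂ _+_ (powLinear-1-1-one j (suc k)) (powLinear-1-1-one j k) ⟩
  j C suc k + j C k
    ≡⟨ [1+n]C[1+k]≡nC[1+k]+nCk j k ⟨
  suc j C suc k ∎

Degree≤ : ℕ → Poly → Set
Degree≤ M f = ∀ k → M < k → f k ≡ 0

Degree≤-mulLinear : ∀ a b {M f} → Degree≤ M f → Degree≤ (suc M) (mulLinear a b f)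
Degree≤-mulLinear a b deg (suc k) (s≤s M<k) =
  trans (cong₂ (λ x y → a * x + b * y) (deg (suc k) (m<n⇒m<1+n M<k)) (deg k M<k))
        (cong₂ _+_ (*-zeroʳ a) (*-zeroʳ b))

Degree≤-powLinear : ∀ a b j {M f} → Degree≤ M f → Degree≤ (j + M) (powLinear a b j f)
Degree≤-powLinear a b zero    deg = deg
Degree≤-powLinear a b (suc j) deg = Degree≤-mulLinear a b (Degree≤-powLinear a b j deg)

Degree≤-powLinear-one : ∀ a b j → Degree≤ j (powLinear a b j one)
Degree≤-powLinear-one a b zero    (suc k) _ = refl
Degree≤-powLinear-one a b (suc j)           = Degree≤-mulLinear a b (Degree≤-powLinear-one a b j)

Ψ : ℕ → Poly → Poly
Ψ M f d = sumBelow (suc M) (λ k → ((M ∸ k) C d) * f k)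

Ψ-cong : ∀ M {f g} → f ≗ g → Ψ M f ≗ Ψ M g
Ψ-cong M f≗g d = sumBelow-cong (suc M) (λ k _ → cong (((M ∸ k) C d) *_) (f≗g k))

Ψ-0-one : Ψ 0 one ≗ one
Ψ-0-one zero    = refl
Ψ-0-one (suc d) = refl

Ψ-suc : ∀ {M f} → Degree≤ M f → Ψ (suc M) f ≗ mulLinear 1 1 (Ψ M f)
Ψ-suc {M} {f} deg d = begin
  Ψ (suc M) f d                                         ≡⟨ cong₂ _+_ (sumBelow-cong (suc M) shift) topVanishes ⟩
  sumBelow (suc M) (λ k → (suc (M ∸ k) C d) * f k) + 0  ≡⟨ +-identityʳ _ ⟩
  sumBelow (suc M) (λ k → (suc (M ∸ k) C d) * f k)      ≡⟨ pascal d ⟩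
  mulLinear 1 1 (Ψ M f) d                               ∎
  where
  shift : ∀ k → k < suc M → ((suc M ∸ k) C d) * f k ≡ (suc (M ∸ k) C d) * f k
  shift k k<1+M = cong (λ z → (z C d) * f k) (+-∸-assoc 1 (≤-pred k<1+M))
  topVanishes : ((suc M ∸ suc M) C d) * f (suc M) ≡ 0
  topVanishes = trans (cong (((suc M ∸ suc M) C d) *_) (deg (suc M) (n<1+n M))) (*-zeroʳ ((suc M ∸ suc M) C d))
  pascal : ∀ d → sumBelow (suc M) (λ k → (suc (M ∸ k) C d) * f k) ≡ mulLinear 1 1 (Ψ M f) d
  pascal zero    = sym (+-identityʳ _)
  pascal (suc d) = begin
    sumBelow (suc M) (λ k → (suc (M ∸ k) C suc d) * f k)
      ≡⟨ sumBelow-cong (suc M) (λ k _ → trans (cong (_* f k) ([1+n]C[1+k]≡nC[1+k]+nCk (M ∸ k) d))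
                                              (*-distribʳ-+ (f k) ((M ∸ k) C suc d) _)) ⟩
    sumBelow (suc M) (λ k → ((M ∸ k) C suc d) * f k + ((M ∸ k) C d) * f k)
      ≡⟨ sumBelow-distrib-+ (suc M) _ _ ⟩
    Ψ M f (suc d) + Ψ M f d
      ≡⟨ mulLinear-1-1 (Ψ M f) d ⟨
    mulLinear 1 1 (Ψ M f) (suc d) ∎

Ψ-mulLinear : ∀ a b M f d → Ψ (suc M) (mulLinear a b f) d ≡ a * Ψ (suc M) f d + b * Ψ M f d
Ψ-mulLinear a b M f d = begin
  Ψ (suc M) (mulLinear a b f) d
    ≡⟨ sumBelow-suc (suc M) _ ⟩
  c₀ * (a * f 0) + sumBelow (suc M) (λ k → c k * (a * f (suc k) + b * f k))
    ≡⟨ cong (c₀ * (a * f 0) +_) split ⟩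
  c₀ * (a * f 0) + (a * sumBelow (suc M) (λ k → c k * f (suc k)) + b * Ψ M f d)
    ≡⟨ factor c₀ a (f 0) _ _ ⟩
  a * (c₀ * f 0 + sumBelow (suc M) (λ k → c k * f (suc k))) + b * Ψ M f d
    ≡⟨ cong (λ z → a * z + b * Ψ M f d) (sumBelow-suc (suc M) _) ⟨
  a * Ψ (suc M) f d + b * Ψ M f d ∎
  where
  c₀ = suc M C d
  c  = λ k → (M ∸ k) C d
  distribute : ∀ a b c x y → c * (a * x + b * y) ≡ a * (c * x) + b * (c * y)
  distribute = solve-∀
  factor : ∀ c a x s t → c * (a * x) + (a * s + t) ≡ a * (c * x + s) + t
  factor = solve-∀
  split : sumBelow (suc M) (λ k → c k * (a * f (suc k) + b * f k))
        ≡ a * sumBelow (suc M) (λ k → c k * f (suc k)) + b * Ψ M f d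
  split = begin
    sumBelow (suc M) (λ k → c k * (a * f (suc k) + b * f k))
      ≡⟨ sumBelow-cong (suc M) (λ k _ → distribute a b (c k) (f (suc k)) (f k)) ⟩
    sumBelow (suc M) (λ k → a * (c k * f (suc k)) + b * (c k * f k))
      ≡⟨ sumBelow-distrib-+ (suc M) _ _ ⟩
    sumBelow (suc M) (λ k → a * (c k * f (suc k))) + sumBelow (suc M) (λ k → b * (c k * f k))
      ≡⟨ cong₂ _+_ (*-distribˡ-sumBelow a (suc M) _) (*-distribˡ-sumBelow b (suc M) _) ⟨
    a * sumBelow (suc M) (λ k → c k * f (suc k)) + b * Ψ M f d ∎

Ψ-suc-mulLinear : ∀ a b {M f} → Degree≤ M f →
                  Ψ (suc M) (mulLinear a b f) ≗ mulLinear (a + b) a (Ψ M f)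
Ψ-suc-mulLinear a b {M} {f} deg d = begin
  Ψ (suc M) (mulLinear a b f) d                 ≡⟨ Ψ-mulLinear a b M f d ⟩
  a * Ψ (suc M) f d + b * Ψ M f d               ≡⟨ cong (λ z → a * z + b * Ψ M f d) (Ψ-suc deg d) ⟩
  a * mulLinear 1 1 (Ψ M f) d + b * Ψ M f d     ≡⟨ regroup d ⟩
  mulLinear (a + b) a (Ψ M f) d                 ∎
  where
  atZero : ∀ a b x → a * (1 * x) + b * x ≡ (a + b) * x
  atZero = solve-∀
  atSuc : ∀ a b x y → a * (1 * x + 1 * y) + b * x ≡ (a + b) * x + a * y
  atSuc = solve-∀
  regroup : ∀ d → a * mulLinear 1 1 (Ψ M f) d + b * Ψ M f d ≡ mulLinear (a + b) a (Ψ M f) d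
  regroup zero    = atZero a b (Ψ M f 0)
  regroup (suc d) = atSuc a b (Ψ M f (suc d)) (Ψ M f d)

Ψ-powLinear : ∀ a b {M f} → Degree≤ M f →
              ∀ j → Ψ (j + M) (powLinear a b j f) ≗ powLinear (a + b) a j (Ψ M f)
Ψ-powLinear a b deg zero    d = refl
Ψ-powLinear a b deg (suc j) d =
  trans (Ψ-suc-mulLinear a b (Degree≤-powLinear a b j deg) d)
        (mulLinear-cong (a + b) a (Ψ-powLinear a b deg j) d)

Ψ-powLinear-powLinear : ∀ a b c e {d m} → d ≤ m →
  Ψ m (powLinear a b (m ∸ d) (powLinear c e d one))
    ≗ powLinear (a + b) a (m ∸ d) (powLinear (c + e) c d one)
Ψ-powLinear-powLinear a b c e {d} {m} d≤m k = begin
  Ψ m (powLinear a b (m ∸ d) (powLinear c e d one)) k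
    ≡⟨ cong (λ z → Ψ z (powLinear a b (m ∸ d) (powLinear c e d one)) k) (m∸n+n≡m d≤m) ⟨
  Ψ (m ∸ d + d) (powLinear a b (m ∸ d) (powLinear c e d one)) k
    ≡⟨ Ψ-powLinear a b (Degree≤-powLinear-one c e d) (m ∸ d) k ⟩
  powLinear (a + b) a (m ∸ d) (Ψ d (powLinear c e d one)) k
    ≡⟨ powLinear-cong (a + b) a (m ∸ d) inner k ⟩
  powLinear (a + b) a (m ∸ d) (powLinear (c + e) c d one) k ∎
  where
  inner : Ψ d (powLinear c e d one) ≗ powLinear (c + e) c d one
  inner k = begin
    Ψ d (powLinear c e d one) k        ≡⟨ cong (λ z → Ψ z (powLinear c e d one) k) (+-identityʳ d) ⟨
    Ψ (d + 0) (powLinear c e d one) k  ≡⟨ Ψ-powLinear c e (Degree≤-powLinear-one c e 0) d k ⟩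
    powLinear (c + e) c d (Ψ 0 one) k  ≡⟨ powLinear-cong (c + e) c d Ψ-0-one k ⟩
    powLinear (c + e) c d one k        ∎

antidiagonalSum : (ℕ → ℕ → ℕ) → ℕ → ℕ
antidiagonalSum h m = sumBelow (suc m) (λ i → h i (m ∸ i))

antidiagonalSum-suc-first : ∀ h m →
  antidiagonalSum h (suc m) ≡ h 0 (suc m) + antidiagonalSum (h ∘ suc) m
antidiagonalSum-suc-first h m = sumBelow-suc (suc m) _

antidiagonalSum-suc-last : ∀ h m →
  antidiagonalSum h (suc m) ≡ sumBelow (suc m) (λ i → h i (suc (m ∸ i))) + h (suc m) 0
antidiagonalSum-suc-last h m =
  cong₂ _+_ (sumBelow-cong (suc m) (λ i i<1+m → cong (h i) (+-∸-assoc 1 (≤-pred i<1+m))))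
            (cong (h (suc m)) (n∸n≡0 m))

antidiagonalSum-recurrence : ∀ c (h : ℕ → ℕ → ℕ) →
  (∀ i j → h (suc i) (suc j) ≡ h i (suc j) + c * h (suc i) j + h i j) →
  (∀ j → h 0 (suc j) ≡ c * h 0 j) →
  (∀ i → h (suc i) 0 ≡ h i 0) →
  ∀ m → antidiagonalSum h (2 + m) ≡ suc c * antidiagonalSum h (1 + m) + antidiagonalSum h m
antidiagonalSum-recurrence c h interior edge₀ edge₁ m = begin
  D (2 + m)
    ≡⟨ antidiagonalSum-suc-first h (suc m) ⟩
  h 0 (2 + m) + antidiagonalSum (h ∘ suc) (suc m)
    ≡⟨ cong (h 0 (2 + m) +_) (antidiagonalSum-suc-last (h ∘ suc) m) ⟩
  h 0 (2 + m) + (sumBelow (suc m) (λ i → h (suc i) (suc (m ∸ i))) + h (2 + m) 0)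
    ≡⟨ cong₂ (λ x y → x + (y + h (2 + m) 0)) (edge₀ (suc m)) middle ⟩
  c * h 0 (1 + m) + ((A + c * B + D m) + h (2 + m) 0)
    ≡⟨ cong (λ z → c * h 0 (1 + m) + ((A + c * B + D m) + z)) (edge₁ (suc m)) ⟩
  c * h 0 (1 + m) + ((A + c * B + D m) + h (1 + m) 0)
    ≡⟨ regroup c (h 0 (1 + m)) A B (D m) (h (1 + m) 0) ⟩
  c * (h 0 (1 + m) + B) + (A + h (1 + m) 0) + D m
    ≡⟨ cong₂ (λ x y → c * x + y + D m) (antidiagonalSum-suc-first h m) (antidiagonalSum-suc-last h m) ⟨
  c * D (1 + m) + D (1 + m) + D m
    ≡⟨ cong (_+ D m) (+-comm (c * D (1 + m)) _) ⟩
  suc c * D (1 + m) + D m ∎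
  where
  D = antidiagonalSum h
  A = sumBelow (suc m) (λ i → h i (suc (m ∸ i)))
  B = antidiagonalSum (h ∘ suc) m
  regroup : ∀ c x a b d y → c * x + ((a + c * b + d) + y) ≡ c * (x + b) + (a + y) + d
  regroup = solve-∀
  middle : sumBelow (suc m) (λ i → h (suc i) (suc (m ∸ i))) ≡ A + c * B + D m
  middle = begin
    sumBelow (suc m) (λ i → h (suc i) (suc (m ∸ i)))
      ≡⟨ sumBelow-cong (suc m) (λ i _ → interior i (m ∸ i)) ⟩
    sumBelow (suc m) (λ i → h i (suc (m ∸ i)) + c * h (suc i) (m ∸ i) + h i (m ∸ i))
      ≡⟨ sumBelow-distrib-+ (suc m) _ _ ⟩
    sumBelow (suc m) (λ i → h i (suc (m ∸ i)) + c * h (suc i) (m ∸ i)) + D m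
      ≡⟨ cong (_+ D m) (sumBelow-distrib-+ (suc m) _ _) ⟩
    A + sumBelow (suc m) (λ i → c * h (suc i) (m ∸ i)) + D m
      ≡⟨ cong (λ z → A + z + D m) (*-distribˡ-sumBelow c (suc m) _) ⟨
    A + c * B + D m ∎

diagCoeff : ℕ → ℕ → ℕ
diagCoeff i j = powLinear 3 2 j (powLinear 2 1 i one) i

diagCoeff-suc-suc : ∀ i j →
  diagCoeff (suc i) (suc j) ≡ diagCoeff i (suc j) + 3 * diagCoeff (suc i) j + diagCoeff i j
diagCoeff-suc-suc i j = begin
  powLinear 3 2 (suc j) (mulLinear 2 1 P) (suc i)
    ≡⟨ powLinear-mulLinear-comm 3 2 2 1 (suc j) P (suc i) ⟩
  2 * (3 * Q (suc i) + 2 * Q i) + 1 * diagCoeff i (suc j)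
    ≡⟨ regroup (Q (suc i)) (Q i) (diagCoeff i (suc j)) ⟩
  diagCoeff i (suc j) + 3 * (2 * Q (suc i) + 1 * Q i) + Q i
    ≡⟨ cong (λ z → diagCoeff i (suc j) + 3 * z + Q i) (powLinear-mulLinear-comm 3 2 2 1 j P (suc i)) ⟨
  diagCoeff i (suc j) + 3 * diagCoeff (suc i) j + diagCoeff i j ∎
  where
  P = powLinear 2 1 i one
  Q = powLinear 3 2 j P
  regroup : ∀ x y z → 2 * (3 * x + 2 * y) + 1 * z ≡ z + 3 * (2 * x + 1 * y) + y
  regroup = solve-∀

diagCoeff-suc-zero : ∀ i → diagCoeff (suc i) 0 ≡ diagCoeff i 0
diagCoeff-suc-zero i =
  trans (cong (λ z → 2 * z + 1 * diagCoeff i 0) (Degree≤-powLinear-one 2 1 i (suc i) (n<1+n i)))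
        (*-identityˡ (diagCoeff i 0))

antidiagonalSum-diagCoeff-recurrence : ∀ m →
  antidiagonalSum diagCoeff (2 + m) ≡ 4 * antidiagonalSum diagCoeff (1 + m) + antidiagonalSum diagCoeff m
antidiagonalSum-diagCoeff-recurrence =
  antidiagonalSum-recurrence 3 diagCoeff diagCoeff-suc-suc (λ _ → refl) diagCoeff-suc-zero

tripleSum≡antidiagonalSum : ∀ m → tripleSum (suc m) ≡ antidiagonalSum diagCoeff m
tripleSum≡antidiagonalSum m = begin
  tripleSum (suc m)
    ≡⟨ sumBelow-cong n (λ k k<n → sumBelow-cong n (λ ℓ ℓ<n → sumBelow-cong n (λ d d<n →
         cong₂ _*_ (cong₂ _*_ (binomℤ-sub1 ℓ d<n) (binomℤ-sub1 d k<n)) (binomℤ-sub1 k ℓ<n)))) ⟩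
  sumBelow n (λ k → sumBelow n (λ ℓ → sumBelow n (λ d → ((m ∸ d) C ℓ) * ((m ∸ k) C d) * ((m ∸ ℓ) C k))))
    ≡⟨ sumBelow-cong n (λ k _ → sumOverℓ k) ⟩
  sumBelow n (λ k → sumBelow n (λ d → ((m ∸ k) C d) * E d k))
    ≡⟨ sumBelow-comm n n _ ⟩
  sumBelow n (λ d → Ψ m (E d) d)
    ≡⟨ sumBelow-cong n (λ d d<n → Ψ-powLinear-powLinear 2 1 1 1 (≤-pred d<n) d) ⟩
  antidiagonalSum diagCoeff m ∎
  where
  n = suc m
  E : ℕ → Poly
  E d = powLinear 2 1 (m ∸ d) (powLinear 1 1 d one)
  binomℤ-sub1 : ∀ {x} y → x < n → binomℤ (sub1 n x) y ≡ (m ∸ x) C y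
  binomℤ-sub1 {x} y x<n =
    cong (λ z → binomℤ z y) (trans (ℤ.[+m]-[+n]≡m⊖n m x) (ℤ.⊖-≥ (≤-pred x<n)))
  rotate : ∀ x y z → x * y * z ≡ y * (z * x)
  rotate = solve-∀
  binomialRow : ∀ d → (m ∸ d) C_ ≗ powLinear 1 1 (m ∸ d) (powLinear 1 0 d one)
  binomialRow d ℓ = trans (sym (powLinear-1-1-one (m ∸ d) ℓ))
                          (powLinear-cong 1 1 (m ∸ d) (λ t → sym (powLinear-1-0 d one t)) ℓ)
  sumOverℓ : ∀ k → sumBelow n (λ ℓ → sumBelow n (λ d → ((m ∸ d) C ℓ) * ((m ∸ k) C d) * ((m ∸ ℓ) C k)))
                 ≡ sumBelow n (λ d → ((m ∸ k) C d) * E d k)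
  sumOverℓ k = begin
    sumBelow n (λ ℓ → sumBelow n (λ d → ((m ∸ d) C ℓ) * ((m ∸ k) C d) * ((m ∸ ℓ) C k)))
      ≡⟨ sumBelow-comm n n _ ⟩
    sumBelow n (λ d → sumBelow n (λ ℓ → ((m ∸ d) C ℓ) * ((m ∸ k) C d) * ((m ∸ ℓ) C k)))
      ≡⟨ sumBelow-cong n (λ d _ → trans (sumBelow-cong n (λ ℓ _ → rotate ((m ∸ d) C ℓ) _ _))
                                        (sym (*-distribˡ-sumBelow ((m ∸ k) C d) n _))) ⟩
    sumBelow n (λ d → ((m ∸ k) C d) * Ψ m ((m ∸ d) C_) k)
      ≡⟨ sumBelow-cong n (λ d d<n → cong (((m ∸ k) C d) *_)
           (trans (Ψ-cong m (binomialRow d) k) (Ψ-powLinear-powLinear 1 1 1 0 (≤-pred d<n) k))) ⟩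
    sumBelow n (λ d → ((m ∸ k) C d) * E d k) ∎

fib-+6 : ∀ k → fib (6 + k) ≡ 4 * fib (3 + k) + fib k
fib-+6 k = unfolded (fib (suc k)) (fib k)
  where
  unfolded : ∀ x y → let f₂ = x + y; f₃ = f₂ + x; f₄ = f₃ + f₂ in (f₄ + f₃) + f₄ ≡ 4 * f₃ + y
  unfolded = solve-∀

fib-3*-recurrence : ∀ m → fib (3 * (3 + m)) ≡ 4 * fib (3 * (2 + m)) + 1 * fib (3 * (1 + m))
fib-3*-recurrence m = begin
  fib (3 * (2 + suc m))
    ≡⟨ cong fib (*-distribˡ-+ 3 2 (suc m)) ⟩
  fib (6 + 3 * suc m)
    ≡⟨ fib-+6 (3 * suc m) ⟩
  4 * fib (3 + 3 * suc m) + fib (3 * suc m)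
    ≡⟨ cong₂ (λ x y → 4 * fib x + y) (*-distribˡ-+ 3 1 (suc m)) (*-identityˡ _) ⟨
  4 * fib (3 * (2 + m)) + 1 * fib (3 * (1 + m)) ∎

linearRecurrence-unique : ∀ a b (u v : ℕ → ℕ) → u 0 ≡ v 0 → u 1 ≡ v 1 →
  (∀ m → u (2 + m) ≡ a * u (1 + m) + b * u m) →
  (∀ m → v (2 + m) ≡ a * v (1 + m) + b * v m) →
  u ≗ v
linearRecurrence-unique a b u v u₀ u₁ recᵤ recᵥ zero          = u₀
linearRecurrence-unique a b u v u₀ u₁ recᵤ recᵥ (suc zero)    = u₁
linearRecurrence-unique a b u v u₀ u₁ recᵤ recᵥ (suc (suc m)) = begin
  u (2 + m)                    ≡⟨ recᵤ m ⟩
  a * u (1 + m) + b * u m      ≡⟨ cong₂ (λ x y → a * x + b * y) (agree (suc m)) (agree m) ⟩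
  a * v (1 + m) + b * v m      ≡⟨ recᵥ m ⟨
  v (2 + m)                    ∎
  where
  agree : u ≗ v
  agree = linearRecurrence-unique a b u v u₀ u₁ recᵤ recᵥ

proposition7p8 : (n : ℕ) → 1 ≤ n → 2 * tripleSum n ≡ fib (3 * n)
proposition7p8 (suc m) _ = begin
  2 * tripleSum (suc m)  ≡⟨ cong (2 *_) (tripleSum≡antidiagonalSum m) ⟩
  2 * D m                ≡⟨ linearRecurrence-unique 4 1 (λ k → 2 * D k) (λ k → fib (3 * suc k))
                              refl refl doubled fib-3*-recurrence m ⟩
  fib (3 * suc m)        ∎
  where
  D = antidiagonalSum diagCoeff
  distribute : ∀ x y → 2 * (4 * x + y) ≡ 4 * (2 * x) + 1 * (2 * y)
  distribute = solve-∀
  doubled : ∀ k → 2 * D (2 + k) ≡ 4 * (2 * D (1 + k)) + 1 * (2 * D k)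
  doubled k = trans (cong (2 *_) (antidiagonalSum-diagCoeff-recurrence k)) (distribute (D (1 + k)) (D k))
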